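{- There is no finite set $Q$ of primes with $2,3\notin Q$ and $|Q|\in\{5,6\}$ such that $$3\cdot \prod_{q\in Q}(q-1) - 2\prod_{q\in Q} q = 2.$$ Consequently, every positive integer $n$ with $\phi(n)=\frac{2}{3}(n+1)$ ($\phi$ Euler's totient) that is not in $\{5,\ 5\cdot 7,\ 5\cdot 7\cdot 37,\ 5\cdot 7\cdot 37\cdot 1297\}$ has at least seven distinct prime factors. -}

module Defs where

open import Data.Nat using (ℕ; suc; _≟_)
open import Data.Nat.GCD using (gcd)
open import Data.List using (List; length; filter; upTo; map)
open import Data.Nat.Divisibility using (_∣_)
open import Data.Nat.Primality using (Prime)
open import Data.List.Membership.Propositional using (_∈_)
open import Data.List.Relation.Unary.Unique.Propositional using (Unique)
open import Data.Product using (_×_)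
open import Function.Bundles using (_⇔_)

-- Euler's totient: φ(n) = #{ k ∈ {1,…,n} : gcd(k,n) = 1 }.
-- (φ(0) = 0 with this definition; only used for n ≥ 1.)
totient : ℕ → ℕ
totient n = length (filter (λ k → gcd k n ≟ 1) (map suc (upTo n)))

IsPrimeFactorList : ℕ → List ℕ → Set
IsPrimeFactorList n P = Unique P × (∀ p → p ∈ P ⇔ (Prime p × p ∣ n))

module Submission where

-- If 3 φ(n) = 2 (n + 1), a prime dividing both n and φ(n) divides 2 (n + 1) - 2 n = 2. Hence n is
-- odd (for even n, φ(n) ≤ n / 2 is too small), 3 ∤ n, and n is squarefree, so n = q₁ ⋯ q_k with
-- distinct primes qᵢ ≥ 5 and the equation becomes 3 ∏ (qᵢ - 1) = 2 ∏ qᵢ + 2. For q₁ < ⋯ < q_k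
-- this is a finite search: with q₁, …, q_{i-1} fixed, the rest of ∏ (q - 1) / ∏ q is at least
-- ((qᵢ - 1) / qᵢ)^(k-i+1), which bounds qᵢ, and the last prime is determined by a linear equation.
-- Run by evaluation, the search finds no solution with 5 or 6 primes and, with at most 4, only
-- 5, 5·7, 5·7·37 and 5·7·37·1297.

open import Defs
open import Data.Bool using (Bool; true; false; T; not; _∧_; _∨_; if_then_else_)
open import Data.Bool.Properties using (T-≡; T-∧; T-∨; T-not-≡; ∧-zeroʳ; ∧-identityʳ; ∧-comm)
open import Data.Bool.ListAction using (all; any)
open import Data.Nat
open import Data.Nat.Properties
open import Data.Nat.DivMod using (m/n*n≤m; m*n%n≡0; m*n/n≡m)
open import Data.Nat.Divisibility
open import Data.Nat.Coprimality using (Coprime; coprime⇒gcd≡1; gcd≡1⇒coprime; coprime-divisor)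
import Data.Nat.Coprimality as Coprime
open import Data.Nat.GCD using (gcd)
open import Data.Nat.ListAction using (product)
open import Data.Nat.ListAction.Properties using (product-↭)
open import Data.Nat.Primality
  using (Prime; prime[2]; ¬prime[0]; ¬prime[1]; euclidsLemma; prime⇒irreducible; prime⇒nonZero;
         composite; composite[4]; composite⇒¬prime; productOfPrimes≢0)
open import Data.Nat.Primality.Factorisation using (factorise)
open import Data.Nat.Tactic.RingSolver using (solve-∀)
open import Data.Integer as ℤ using (+_)
import Data.Integer.Properties as ℤ
import Data.Integer.Tactic.RingSolver as ℤ
open import Data.List using (List; []; _∷_; _++_; [_]; length; map; filter; upTo)
open import Data.List.Properties using (length-++; map-++; upTo-∷ʳ; filter-++)
open import Data.List.Membership.Propositional using (_∈_; _∉_)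
open import Data.List.Relation.Unary.All as All using (All; []; _∷_)
open import Data.List.Relation.Unary.All.Properties using (all⁻; All¬⇒¬Any)
open import Data.List.Relation.Unary.AllPairs as AllPairs using (AllPairs; []; _∷_)
open import Data.List.Relation.Unary.Any as Any using (here; there)
open import Data.List.Relation.Unary.Any.Properties using (any⁻)
open import Data.List.Relation.Unary.Linked.Properties using (Linked⇒AllPairs)
open import Data.List.Relation.Unary.Unique.Propositional using (Unique)
open import Data.List.Relation.Binary.Permutation.Propositional using (_↭_; ↭-sym; ↭⇒↭ₛ)
open import Data.List.Relation.Binary.Permutation.Propositional.Properties using (All-resp-↭; ↭-length; map⁺)
import Data.List.Relation.Binary.Permutation.Setoid.Properties as Permutationₛ
open import Data.List.Sort ≤-decTotalOrder using (sort; sort-↭; sort-↗)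
open import Data.Product using (_×_; _,_; proj₁; proj₂)
open import Data.Sum as Sum using (_⊎_; inj₁; inj₂)
open import Function using (_∘_; _⇔_)
open import Function.Bundles using (Equivalence; mk⇔)
open import Level using (0ℓ)
open import Relation.Binary.PropositionalEquality hiding ([_])
open import Relation.Nullary using (¬_; Dec; does; yes; no; contradiction)
open import Relation.Nullary.Decidable using (dec-true; dec-false; does-⇔; toWitness)
open import Relation.Unary using (Pred; Decidable)

open Equivalence using (to; from)

-- Counting and Euler's totient

bit : Bool → ℕ
bit b = if b then 1 else 0

count : (ℕ → Bool) → ℕ → ℕ
count f zero    = 0
count f (suc N) = count f N + bit (f (suc N))

count-cong : ∀ {f g} N → (∀ {k} → 1 ≤ k → k ≤ N → f k ≡ g k) → count f N ≡ count g N
count-cong zero    f≗g = refl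
count-cong (suc N) f≗g =
  cong₂ _+_ (count-cong N (λ 1≤k k≤N → f≗g 1≤k (m≤n⇒m≤1+n k≤N))) (cong bit (f≗g (s≤s z≤n) ≤-refl))

count-+ : ∀ (f : ℕ → Bool) m n → count f (m + n) ≡ count f m + count (λ k → f (m + k)) n
count-+ f m zero    = trans (cong (count f) (+-identityʳ m)) (sym (+-identityʳ _))
count-+ f m (suc n) = begin
  count f (m + suc n)                                         ≡⟨ cong (count f) (+-suc m n) ⟩
  count f (m + n) + bit (f (suc (m + n)))                     ≡⟨ cong₂ _+_ (count-+ f m n) (cong (bit ∘ f) (sym (+-suc m n))) ⟩
  count f m + count (λ k → f (m + k)) n + bit (f (m + suc n)) ≡⟨ +-assoc (count f m) _ _ ⟩
  count f m + count (λ k → f (m + k)) (suc n)                 ∎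
  where open ≡-Reasoning

count-periodic : ∀ (f : ℕ → Bool) n → (∀ k → f (n + k) ≡ f k) → ∀ q → count f (q * n) ≡ q * count f n
count-periodic f n periodic zero    = refl
count-periodic f n periodic (suc q) = begin
  count f (n + q * n)                          ≡⟨ count-+ f n (q * n) ⟩
  count f n + count (λ k → f (n + k)) (q * n)  ≡⟨ cong (_+_ (count f n)) (count-cong (q * n) (λ {k} _ _ → periodic k)) ⟩
  count f n + count f (q * n)                  ≡⟨ cong (_+_ (count f n)) (count-periodic f n periodic q) ⟩
  count f n + q * count f n                    ∎
  where open ≡-Reasoning

count-partition : ∀ (f g : ℕ → Bool) N → count (λ k → f k ∧ g k) N + count (λ k → f k ∧ not (g k)) N ≡ count f N
count-partition f g zero    = refl
count-partition f g (suc N) = begin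
  (A + bit (f′ ∧ g′)) + (B + bit (f′ ∧ not g′))  ≡⟨ +-shuffle A B _ _ ⟩
  (A + B) + (bit (f′ ∧ g′) + bit (f′ ∧ not g′))  ≡⟨ cong₂ _+_ (count-partition f g N) (split f′ g′) ⟩
  count f N + bit f′                             ∎
  where
  open ≡-Reasoning
  f′ g′ : Bool
  f′ = f (suc N)
  g′ = g (suc N)
  A B : ℕ
  A = count (λ k → f k ∧ g k) N
  B = count (λ k → f k ∧ not (g k)) N
  +-shuffle : ∀ a b x y → (a + x) + (b + y) ≡ (a + b) + (x + y)
  +-shuffle = solve-∀
  split : ∀ x y → bit (x ∧ y) + bit (x ∧ not y) ≡ bit x
  split true  true  = refl
  split true  false = refl
  split false _     = refl

count-false : ∀ {f} N → (∀ {k} → 1 ≤ k → k ≤ N → f k ≡ false) → count f N ≡ 0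
count-false zero    _     = refl
count-false (suc N) f≡false = cong₂ _+_ (count-false N (λ 1≤k k≤N → f≡false 1≤k (m≤n⇒m≤1+n k≤N)))
                                        (cong bit (f≡false (s≤s z≤n) ≤-refl))

count-mono : ∀ {f g} N → (∀ {k} → T (f k) → T (g k)) → count f N ≤ count g N
count-mono zero    _   = z≤n
count-mono {f} {g} (suc N) f⇒g = +-mono-≤ (count-mono N f⇒g) (bit-mono (f (suc N)) (g (suc N)) f⇒g)
  where
  bit-mono : ∀ x y → (T x → T y) → bit x ≤ bit y
  bit-mono false _     _   = z≤n
  bit-mono true  true  _   = ≤-refl
  bit-mono true  false x⇒y = contradiction (x⇒y _) λ ()

count-multiples : ∀ p .{{_ : NonZero p}} h N → count (λ k → does (p ∣? k) ∧ h k) (N * p) ≡ count (h ∘ (_* p)) N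
count-multiples p          h zero    = refl
count-multiples p@(suc p′) h (suc N) = begin
  count F (p + N * p)                                  ≡⟨ cong (count F) (+-comm p (N * p)) ⟩
  count F (N * p + p)                                  ≡⟨ count-+ F (N * p) p ⟩
  count F (N * p) + (count (λ k → F (N * p + k)) p′ + bit (F (N * p + p)))
    ≡⟨ cong₂ _+_ (count-multiples p h N) (cong₂ _+_ (count-false p′ non-multiple) (cong bit last)) ⟩
  count (h ∘ (_* p)) N + bit (h (suc N * p))           ≡⟨⟩
  count (h ∘ (_* p)) (suc N)                           ∎
  where
  open ≡-Reasoning
  F : ℕ → Bool
  F k = does (p ∣? k) ∧ h k
  non-multiple : ∀ {k} → 1 ≤ k → k ≤ p′ → F (N * p + k) ≡ false
  non-multiple {k@(suc _)} _ k≤p′ = cong (_∧ h (N * p + k)) (dec-false (p ∣? N * p + k) λ p∣ →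
    <-irrefl refl (≤-trans (s≤s k≤p′) (∣⇒≤ (∣m+n∣m⇒∣n p∣ (n∣m*n N)))))
  last : F (N * p + p) ≡ h (suc N * p)
  last = trans (cong (_∧ h (N * p + p)) (dec-true (p ∣? N * p + p) (∣m∣n⇒∣m+n (n∣m*n N) ∣-refl)))
             (cong h (+-comm (N * p) p))

length-filter-range : ∀ {P : Pred ℕ 0ℓ} (P? : Decidable P) N →
                    length (filter P? (map suc (upTo N))) ≡ count (does ∘ P?) N
length-filter-range P? zero    = refl
length-filter-range P? (suc N) = begin
  length (filter P? (map suc (upTo (suc N))))                    ≡⟨ cong (length ∘ filter P? ∘ map suc) (sym (upTo-∷ʳ N)) ⟩
  length (filter P? (map suc (upTo N ++ [ N ])))                 ≡⟨ cong (length ∘ filter P?) (map-++ suc (upTo N) [ N ]) ⟩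
  length (filter P? (map suc (upTo N) ++ [ suc N ]))             ≡⟨ cong length (filter-++ P? (map suc (upTo N)) [ suc N ]) ⟩
  length (filter P? (map suc (upTo N)) ++ filter P? [ suc N ])   ≡⟨ length-++ (filter P? (map suc (upTo N))) ⟩
  length (filter P? (map suc (upTo N))) + length (filter P? [ suc N ])
                                                               ≡⟨ cong₂ _+_ (length-filter-range P? N) (singleton (suc N)) ⟩
  count (does ∘ P?) (suc N)                                      ∎
  where
  open ≡-Reasoning
  singleton : ∀ k → length (filter P? [ k ]) ≡ bit (does (P? k))
  singleton k with does (P? k)
  ... | true  = refl
  ... | false = refl

coprimeTo : ℕ → ℕ → Bool
coprimeTo n k = does (gcd k n ≟ 1)

totient≡count : ∀ n → totient n ≡ count (coprimeTo n) n
totient≡count n = length-filter-range (λ k → gcd k n ≟ 1) n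

T-does : ∀ {a} {A : Set a} (a? : Dec A) → T (does a?) → A
T-does (yes a) _ = a

coprimeTo⇒coprime : ∀ {n k} → T (coprimeTo n k) → Coprime k n
coprimeTo⇒coprime {n} {k} k⊥n = gcd≡1⇒coprime (T-does (gcd k n ≟ 1) k⊥n)

coprimeTo-cong : ∀ {n k n′ k′} → (Coprime k n → Coprime k′ n′) → (Coprime k′ n′ → Coprime k n) →
               coprimeTo n k ≡ coprimeTo n′ k′
coprimeTo-cong {n} {k} {n′} {k′} to from =
  does-⇔ (mk⇔ (coprime⇒gcd≡1 ∘ to ∘ gcd≡1⇒coprime) (coprime⇒gcd≡1 ∘ from ∘ gcd≡1⇒coprime))
       (gcd k n ≟ 1) (gcd k′ n′ ≟ 1)

coprime-∣ʳ : ∀ {k n d} → Coprime k n → d ∣ n → Coprime k d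
coprime-∣ʳ k⊥n d∣n (i∣k , i∣d) = k⊥n (i∣k , ∣-trans i∣d d∣n)

coprime-∣ˡ : ∀ {k n d} → Coprime k n → d ∣ k → Coprime d n
coprime-∣ˡ k⊥n d∣k (i∣d , i∣n) = k⊥n (∣-trans i∣d d∣k , i∣n)

coprime-* : ∀ {k m n} → Coprime k m → Coprime k n → Coprime k (m * n)
coprime-* k⊥m k⊥n (i∣k , i∣mn) = k⊥n (i∣k , coprime-divisor (coprime-∣ˡ k⊥m i∣k) i∣mn)

prime⇒coprime-¬∣ : ∀ {p k} → Prime p → ¬ p ∣ k → Coprime k p
prime⇒coprime-¬∣ p-prime p∤k {i} (i∣k , i∣p) with prime⇒irreducible p-prime i∣p
... | inj₁ i≡1 = i≡1
... | inj₂ refl = contradiction i∣k p∤k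

coprimeTo-periodic : ∀ m k → coprimeTo m (m + k) ≡ coprimeTo m k
coprimeTo-periodic m k = coprimeTo-cong {m} {m + k} {m} {k}
  (λ m+k⊥m (i∣k , i∣m) → m+k⊥m (∣m∣n⇒∣m+n i∣m i∣k , i∣m))
  (λ k⊥m (i∣m+k , i∣m) → k⊥m (∣m+n∣m⇒∣n i∣m+k i∣m , i∣m))

count-coprimeTo-periods : ∀ q m → count (coprimeTo m) (q * m) ≡ q * totient m
count-coprimeTo-periods q m =
  trans (count-periodic (coprimeTo m) m (coprimeTo-periodic m) q) (cong (q *_) (sym (totient≡count m)))

totient-*ˡ-∣ : ∀ {p m} → p ∣ m → totient (p * m) ≡ p * totient m
totient-*ˡ-∣ {p} {m} p∣m = begin
  totient (p * m)                    ≡⟨ totient≡count (p * m) ⟩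
  count (coprimeTo (p * m)) (p * m)  ≡⟨ count-cong (p * m) (λ {k} _ _ → coprimeTo-cong {p * m} {k} {m} {k}
                                        (λ k⊥pm → coprime-∣ʳ k⊥pm (n∣m*n p))
                                        (λ k⊥m → coprime-* (coprime-∣ʳ k⊥m p∣m) k⊥m)) ⟩
  count (coprimeTo m) (p * m)        ≡⟨ count-coprimeTo-periods p m ⟩
  p * totient m                      ∎
  where open ≡-Reasoning

totient-*ˡ-prime : ∀ {p m} → Prime p → ¬ p ∣ m → totient (p * m) ≡ (p ∸ 1) * totient m
totient-*ˡ-prime {p} {m} p-prime p∤m = begin
  totient (p * m)                          ≡⟨ m+n∸n≡m (totient (p * m)) (totient m) ⟨
  totient (p * m) + totient m ∸ totient m  ≡⟨ cong (_∸ totient m) sum ⟩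
  p * totient m ∸ totient m                ≡⟨ cong (p * totient m ∸_) (*-identityˡ (totient m)) ⟨
  p * totient m ∸ 1 * totient m            ≡⟨ *-distribʳ-∸ (totient m) p 1 ⟨
  (p ∸ 1) * totient m                      ∎
  where
  open ≡-Reasoning
  p∣_ : ℕ → Bool
  p∣ k = does (p ∣? k)
  coprime-to-pm : ∀ k → coprimeTo (p * m) k ≡ coprimeTo m k ∧ not (p∣ k)
  coprime-to-pm k with p ∣? k
  ... | yes p∣k = trans (dec-false (gcd k (p * m) ≟ 1) λ gcd≡1 →
                         ¬prime[1] (subst Prime (gcd≡1⇒coprime gcd≡1 (p∣k , m∣m*n m)) p-prime))
                      (sym (∧-zeroʳ (coprimeTo m k)))
  ... | no  p∤k = trans (coprimeTo-cong {p * m} {k} {m} {k} (λ k⊥pm → coprime-∣ʳ k⊥pm (n∣m*n p))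
                                       (coprime-* (prime⇒coprime-¬∣ p-prime p∤k)))
                      (sym (∧-identityʳ (coprimeTo m k)))
  multiples : count (λ k → coprimeTo m k ∧ p∣ k) (p * m) ≡ totient m
  multiples = begin
    count (λ k → coprimeTo m k ∧ p∣ k) (p * m)  ≡⟨ count-cong (p * m) (λ {k} _ _ → ∧-comm (coprimeTo m k) (p∣ k)) ⟩
    count (λ k → p∣ k ∧ coprimeTo m k) (p * m)  ≡⟨ cong (count _) (*-comm p m) ⟩
    count (λ k → p∣ k ∧ coprimeTo m k) (m * p)  ≡⟨ count-multiples p {{prime⇒nonZero p-prime}} (coprimeTo m) m ⟩
    count (coprimeTo m ∘ (_* p)) m              ≡⟨ count-cong m (λ {j} _ _ → coprimeTo-cong {m} {j * p} {m} {j}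
                                                   (λ jp⊥m → coprime-∣ˡ jp⊥m (m∣m*n p))
                                                   (λ j⊥m → Coprime.sym (coprime-* (Coprime.sym j⊥m) p⊥m))) ⟩
    count (coprimeTo m) m                       ≡⟨ sym (totient≡count m) ⟩
    totient m                                   ∎
    where
    p⊥m : Coprime m p
    p⊥m = prime⇒coprime-¬∣ p-prime p∤m
  sum : totient (p * m) + totient m ≡ p * totient m
  sum = begin
    totient (p * m) + totient m
      ≡⟨ cong₂ _+_ (trans (totient≡count (p * m)) (count-cong (p * m) (λ _ _ → coprime-to-pm _))) (sym multiples) ⟩
    count (λ k → coprimeTo m k ∧ not (p∣ k)) (p * m) + count (λ k → coprimeTo m k ∧ p∣ k) (p * m)
      ≡⟨ +-comm (count (λ k → coprimeTo m k ∧ not (p∣ k)) (p * m)) _ ⟩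
    count (λ k → coprimeTo m k ∧ p∣ k) (p * m) + count (λ k → coprimeTo m k ∧ not (p∣ k)) (p * m)
      ≡⟨ count-partition (coprimeTo m) p∣_ (p * m) ⟩
    count (coprimeTo m) (p * m)
      ≡⟨ count-coprimeTo-periods p m ⟩
    p * totient m
      ∎

even⇒2*totient≤n : ∀ {n} → 2 ∣ n → 2 * totient n ≤ n
even⇒2*totient≤n {.(m * 2)} (divides-refl m) = begin
  2 * totient (m * 2)                     ≡⟨ cong (2 *_) (totient≡count (m * 2)) ⟩
  2 * count (coprimeTo (m * 2)) (m * 2)   ≤⟨ *-monoʳ-≤ 2 (count-mono (m * 2) (λ {k} → coprime⇒odd {k})) ⟩
  2 * count odd (m * 2)                   ≡⟨ cong (2 *_) (count-periodic odd 2 odd-periodic m) ⟩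
  2 * (m * 1)                             ≡⟨ cong (2 *_) (*-identityʳ m) ⟩
  2 * m                                   ≡⟨ *-comm 2 m ⟩
  m * 2                                   ∎
  where
  open ≤-Reasoning
  odd : ℕ → Bool
  odd k = not (does (2 ∣? k))
  odd-periodic : ∀ k → odd (2 + k) ≡ odd k
  odd-periodic k =
    cong not (does-⇔ (mk⇔ (λ 2∣2+k → ∣m+n∣m⇒∣n 2∣2+k ∣-refl) (∣m∣n⇒∣m+n ∣-refl)) (2 ∣? 2 + k) (2 ∣? k))
  coprime⇒odd : ∀ {k} → T (coprimeTo (m * 2) k) → T (odd k)
  coprime⇒odd {k} k⊥n = from T-not-≡ (dec-false (2 ∣? k) λ 2∣k →
    contradiction (coprimeTo⇒coprime {m * 2} {k} k⊥n (2∣k , n∣m*n m)) λ ())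

-- Squarefree numbers and the equation 3 φ(n) = 2 (n + 1)

predProduct : List ℕ → ℕ
predProduct L = product (map (_∸ 1) L)

SquareFree : ℕ → Set
SquareFree n = ∀ {p} → Prime p → ¬ p * p ∣ n

prime∣2⇒≡2 : ∀ {p} → Prime p → p ∣ 2 → p ≡ 2
prime∣2⇒≡2 p-prime p∣2 with prime⇒irreducible prime[2] p∣2
... | inj₁ refl = contradiction p-prime ¬prime[1]
... | inj₂ p≡2  = p≡2

squareFree-∣ : ∀ {m n} → m ∣ n → SquareFree n → SquareFree m
squareFree-∣ m∣n n-squareFree p-prime pp∣m = n-squareFree p-prime (∣-trans pp∣m m∣n)

primeFactorList⇒product : ∀ {n P} → 1 ≤ n → SquareFree n → IsPrimeFactorList n P →
                          n ≡ product P × totient n ≡ predProduct P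
primeFactorList⇒product {n} {[]} 1≤n _ (_ , P⇔) with factorise n {{>-nonZero 1≤n}}
... | record { factors = [] ; isFactorisation = refl } = refl , refl
... | record { factors = q ∷ _ ; isFactorisation = n≡ ; factorsPrime = q-prime ∷ _ }
  with () ← from (P⇔ q) (q-prime , subst (q ∣_) (sym n≡) (m∣m*n _))
primeFactorList⇒product {n} {p ∷ P} 1≤n n-squareFree (p∉P ∷ P-unique , P⇔)
  with to (P⇔ p) (here refl)
... | p-prime , divides m n≡m*p =
  trans n≡p*m (cong (p *_) (proj₁ ih)) ,
  trans (cong totient n≡p*m) (trans (totient-*ˡ-prime p-prime p∤m) (cong ((p ∸ 1) *_) (proj₂ ih)))
  where
  n≡p*m : n ≡ p * m
  n≡p*m = trans n≡m*p (*-comm m p)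
  1≤m : 1 ≤ m
  1≤m = >-nonZero⁻¹ m {{m*n≢0⇒m≢0 m {{subst NonZero n≡m*p (>-nonZero 1≤n)}}}}
  p∤m : ¬ p ∣ m
  p∤m p∣m = n-squareFree p-prime (subst (p * p ∣_) (sym n≡p*m) (*-monoʳ-∣ p p∣m))
  P⇔m : ∀ q → q ∈ P ⇔ (Prime q × q ∣ m)
  P⇔m q = mk⇔ factor-of-m factor-in-P
    where
    factor-of-m : q ∈ P → Prime q × q ∣ m
    factor-of-m q∈P with to (P⇔ q) (there q∈P)
    ... | q-prime , q∣n with euclidsLemma p m q-prime (subst (q ∣_) n≡p*m q∣n)
    ...   | inj₂ q∣m = q-prime , q∣m
    ...   | inj₁ q∣p with prime⇒irreducible p-prime q∣p
    ...     | inj₁ refl = contradiction q-prime ¬prime[1]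
    ...     | inj₂ refl = contradiction refl (All.lookup p∉P q∈P)
    factor-in-P : Prime q × q ∣ m → q ∈ P
    factor-in-P (q-prime , q∣m) with from (P⇔ q) (q-prime , subst (q ∣_) (sym n≡p*m) (∣n⇒∣m*n p q∣m))
    ... | here refl = contradiction q∣m p∤m
    ... | there q∈P = q∈P
  ih : m ≡ product P × totient m ≡ predProduct P
  ih = primeFactorList⇒product 1≤m (squareFree-∣ (divides p n≡p*m) n-squareFree) (P-unique , P⇔m)

TotientEquation : ℕ → Set
TotientEquation n = 3 * totient n ≡ 2 * (n + 1)

equation-common-divisor : ∀ {n d} → TotientEquation n → d ∣ n → d ∣ 3 * totient n → d ∣ 2
equation-common-divisor {n} {d} eq d∣n d∣3φ =
  ∣m+n∣m⇒∣n (subst (d ∣_) (trans eq (*-distribˡ-+ 2 n 1)) d∣3φ) (∣n⇒∣m*n 2 d∣n)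

equation⇒odd : ∀ {n} → TotientEquation n → ¬ 2 ∣ n
equation⇒odd {n} eq 2∣n = <-irrefl refl (begin-strict
  3 * n                  <⟨ m<m+n (3 * n) z<s ⟩
  3 * n + (4 + n)        ≡⟨ 4[n+1] n ⟩
  2 * (2 * (n + 1))      ≡⟨ cong (2 *_) eq ⟨
  2 * (3 * totient n)    ≡⟨ x*[y*z]≡y*[x*z] 2 3 (totient n) ⟩
  3 * (2 * totient n)    ≤⟨ *-monoʳ-≤ 3 (even⇒2*totient≤n 2∣n) ⟩
  3 * n                  ∎)
  where
  open ≤-Reasoning
  4[n+1] : ∀ n → 3 * n + (4 + n) ≡ 2 * (2 * (n + 1))
  4[n+1] = solve-∀
  x*[y*z]≡y*[x*z] : ∀ x y z → x * (y * z) ≡ y * (x * z)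
  x*[y*z]≡y*[x*z] = solve-∀

equation⇒3∤ : ∀ {n} → TotientEquation n → ¬ 3 ∣ n
equation⇒3∤ {n} eq 3∣n =
  contradiction (∣⇒≤ (equation-common-divisor eq 3∣n (m∣m*n (totient n)))) λ { (s≤s (s≤s ())) }

equation⇒squareFree : ∀ {n} → TotientEquation n → SquareFree n
equation⇒squareFree {n} eq {p} p-prime (divides c n≡c*pp) =
  equation⇒odd eq (subst (_∣ n) (prime∣2⇒≡2 p-prime p∣2) (divides (c * p) n≡[c*p]*p))
  where
  n≡p*[p*c] : n ≡ p * (p * c)
  n≡p*[p*c] = trans n≡c*pp (x*[y*y]≡y*[y*x] c p)
    where
    x*[y*y]≡y*[y*x] : ∀ x y → x * (y * y) ≡ y * (y * x)
    x*[y*y]≡y*[y*x] = solve-∀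
  n≡[c*p]*p : n ≡ c * p * p
  n≡[c*p]*p = trans n≡c*pp (sym (*-assoc c p p))
  φ≡p*φ[p*c] : totient n ≡ p * totient (p * c)
  φ≡p*φ[p*c] = trans (cong totient n≡p*[p*c]) (totient-*ˡ-∣ {p} {p * c} (m∣m*n c))
  p∣2 : p ∣ 2
  p∣2 = equation-common-divisor eq (divides (c * p) n≡[c*p]*p)
          (∣n⇒∣m*n 3 (subst (p ∣_) (sym φ≡p*φ[p*c]) (m∣m*n (totient (p * c)))))

-- The equation a ∏ (q - 1) = b ∏ q + 2 over lists of primes

Solves : ℕ → ℕ → List ℕ → Set
Solves a b L = a * predProduct L ≡ b * product L + 2

predProduct≤product : ∀ L → predProduct L ≤ product L
predProduct≤product []      = ≤-refl
predProduct≤product (x ∷ L) = *-mono-≤ (m∸n≤m x 1) (predProduct≤product L)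

pow≤product : ∀ {p L} → All (p ≤_) L → p ^ length L ≤ product L
pow≤product []          = ≤-refl
pow≤product (p≤x ∷ p≤L) = *-mono-≤ p≤x (pow≤product p≤L)

pred*≤*pred : ∀ {p x} → p ≤ x → (p ∸ 1) * x ≤ p * (x ∸ 1)
pred*≤*pred {zero}              _         = z≤n
pred*≤*pred {suc p} {suc x} (s≤s p≤x) = begin
  p * suc x  ≡⟨ *-suc p x ⟩
  p + p * x  ≤⟨ +-monoˡ-≤ (p * x) p≤x ⟩
  x + p * x  ∎
  where open ≤-Reasoning

ratio-bound : ∀ {p L} → All (p ≤_) L → (p ∸ 1) ^ length L * product L ≤ p ^ length L * predProduct L
ratio-bound                 []          = ≤-refl
ratio-bound {p} {x ∷ L} (p≤x ∷ p≤L) = begin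
  (p ∸ 1) * (p ∸ 1) ^ n * (x * product L)   ≡⟨ interchange (p ∸ 1) _ x _ ⟩
  (p ∸ 1) * x * ((p ∸ 1) ^ n * product L)   ≤⟨ *-mono-≤ (pred*≤*pred p≤x) (ratio-bound p≤L) ⟩
  p * (x ∸ 1) * (p ^ n * predProduct L)     ≡⟨ interchange p _ (p ^ n) _ ⟩
  p * p ^ n * ((x ∸ 1) * predProduct L)     ∎
  where
  open ≤-Reasoning
  n : ℕ
  n = length L
  interchange : ∀ a b c d → a * b * (c * d) ≡ a * c * (b * d)
  interchange = solve-∀

solution-b<a : ∀ {a b X Y} → a * X ≡ b * Y + 2 → X ≤ Y → b < a
solution-b<a {a} {b} {X} {Y} eq X≤Y = ≰⇒> λ a≤b → <-irrefl eq (begin-strict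
  a * X      ≤⟨ *-mono-≤ a≤b X≤Y ⟩
  b * Y      <⟨ m<m+n (b * Y) z<s ⟩
  b * Y + 2  ∎)
  where open ≤-Reasoning

solution-bound : ∀ {a b X Y P Q} .{{_ : NonZero Y}} → a * X ≡ b * Y + 2 → Q * Y ≤ P * X → P ≤ Y →
                 a * Q ≤ b * P + 2
solution-bound {a} {b} {X} {Y} {P} {Q} eq QY≤PX P≤Y = *-cancelʳ-≤ (a * Q) (b * P + 2) Y (begin
  a * Q * Y          ≡⟨ *-assoc a Q Y ⟩
  a * (Q * Y)        ≤⟨ *-monoʳ-≤ a QY≤PX ⟩
  a * (P * X)        ≡⟨ x*[y*z]≡y*[x*z] a P X ⟩
  P * (a * X)        ≡⟨ cong (P *_) eq ⟩
  P * (b * Y + 2)    ≡⟨ expand P b Y ⟩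
  b * P * Y + P * 2  ≤⟨ +-monoʳ-≤ (b * P * Y) (*-monoˡ-≤ 2 P≤Y) ⟩
  b * P * Y + Y * 2  ≡⟨ collect b P Y ⟩
  (b * P + 2) * Y    ∎)
  where
  open ≤-Reasoning
  x*[y*z]≡y*[x*z] : ∀ x y z → x * (y * z) ≡ y * (x * z)
  x*[y*z]≡y*[x*z] = solve-∀
  expand : ∀ P b Y → P * (b * Y + 2) ≡ b * P * Y + P * 2
  expand = solve-∀
  collect : ∀ b P Y → b * P * Y + Y * 2 ≡ (b * P + 2) * Y
  collect = solve-∀

exceedsBound : ℕ → ℕ → ℕ → ℕ → Bool
exceedsBound m a b p = b * p ^ m + 2 <ᵇ a * (p ∸ 1) ^ m

¬exceedsBound : ∀ {a b p L} → All (p ≤_) L → All Prime L → Solves a b L → ¬ T (exceedsBound (length L) a b p)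
¬exceedsBound {a} {b} {p} {L} p≤L primes eq exceeds =
  <⇒≱ (<ᵇ⇒< _ _ exceeds)
      (solution-bound {a} {b} {Q = (p ∸ 1) ^ length L} {{productOfPrimes≢0 primes}} eq (ratio-bound p≤L) (pow≤product p≤L))

solves-singleton : ∀ {a b q} → 1 ≤ q → Solves a b (q ∷ []) → q * (a ∸ b) ≡ a + 2
solves-singleton {a} {b} {q@(suc q′)} _ eq = begin
  q * (a ∸ b)              ≡⟨ *-distribˡ-∸ q a b ⟩
  q * a ∸ q * b            ≡⟨ cong₂ _∸_ qa≡bq+[a+2] (*-comm q b) ⟩
  b * q + (a + 2) ∸ b * q  ≡⟨ m+n∸m≡n (b * q) (a + 2) ⟩
  a + 2                    ∎
  where
  open ≡-Reasoning
  a[q-1]≡bq+2 : a * q′ ≡ b * q + 2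
  a[q-1]≡bq+2 = trans (cong (a *_) (sym (*-identityʳ q′))) (trans eq (cong (λ y → b * y + 2) (*-identityʳ q)))
  rearrange : ∀ a x → a + (x + 2) ≡ x + (a + 2)
  rearrange = solve-∀
  qa≡bq+[a+2] : q * a ≡ b * q + (a + 2)
  qa≡bq+[a+2] = begin
    q * a            ≡⟨ *-comm q a ⟩
    a * q            ≡⟨ *-suc a q′ ⟩
    a + a * q′       ≡⟨ cong (_+_ a) a[q-1]≡bq+2 ⟩
    a + (b * q + 2)  ≡⟨ rearrange a (b * q) ⟩
    b * q + (a + 2)  ∎

-- The search

infixr 4 _⇒ᵇ_
_⇒ᵇ_ : Bool → Bool → Bool
true  ⇒ᵇ y = y
false ⇒ᵇ y = true

T-⇒ᵇ : ∀ x {y} → T (x ⇒ᵇ y) → T x → T y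
T-⇒ᵇ true x⇒y _ = x⇒y

T-∨-not : ∀ x {y} → T (x ∨ not y) → T y → T x
T-∨-not true          _  _  = _
T-∨-not false {true}  () _
T-∨-not false {false} _  ()

passesTrialDivision : List ℕ → ℕ → Bool
passesTrialDivision ds p = all (λ d → (p ≤ᵇ d) ∨ not (does (d ∣? p))) ds

prime⇒passesTrialDivision : ∀ {ds p} → All (2 ≤_) ds → Prime p → T (passesTrialDivision ds p)
prime⇒passesTrialDivision {p = p} ds≥2 p-prime = all⁻ _ (All.map survives ds≥2)
  where
  survives : ∀ {d} → 2 ≤ d → T ((p ≤ᵇ d) ∨ not (does (d ∣? p)))
  survives {d} 2≤d with d ∣? p
  ... | no _    = from (T-∨ {p ≤ᵇ d}) (inj₂ _)
  ... | yes d∣p with prime⇒irreducible p-prime d∣p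
  ...   | inj₁ refl = contradiction 2≤d λ { (s≤s ()) }
  ...   | inj₂ refl = from (T-∨ {p ≤ᵇ p}) (inj₁ (≤⇒≤ᵇ (≤-refl {p})))

smallPrimes : List ℕ
smallPrimes = 2 ∷ 3 ∷ 5 ∷ 7 ∷ 11 ∷ 13 ∷ 17 ∷ 19 ∷ 23 ∷ 29 ∷ 31 ∷ 37 ∷ 41 ∷ 43 ∷ 47 ∷ []

smallPrimes≥2 : All (2 ≤_) smallPrimes
smallPrimes≥2 = toWitness {a? = All.all? (2 ≤?_) smallPrimes} _

prime-mod-6 : ∀ {p x} → 6 ∣ suc p → p ≤ x → Prime x → x ≡ p ⊎ x ≡ 2 + p ⊎ 6 + p ≤ x
prime-mod-6 {p} {x} 6∣1+p p≤x x-prime =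
  subst (λ x → x ≡ p ⊎ x ≡ 2 + p ⊎ 6 + p ≤ x) x∸p+p≡x
    (classify (x ∸ p) (subst Prime (sym x∸p+p≡x) x-prime))
  where
  x∸p+p≡x : x ∸ p + p ≡ x
  x∸p+p≡x = m∸n+n≡m p≤x
  2∣1+p : 2 ∣ suc p
  2∣1+p = ∣-trans (divides 3 refl) 6∣1+p
  3∣1+p : 3 ∣ suc p
  3∣1+p = ∣-trans (divides 2 refl) 6∣1+p
  excluded : ∀ {d} o .{{_ : NonTrivial d}} → d < 6 → d ∣ o + suc p → ¬ Prime (o + suc p)
  excluded o d<6 d∣x =
    composite⇒¬prime (composite (<-≤-trans d<6 (≤-trans (∣⇒≤ 6∣1+p) (m≤n+m (suc p) o))) d∣x)
  classify : ∀ o → Prime (o + p) → o + p ≡ p ⊎ o + p ≡ 2 + p ⊎ 6 + p ≤ o + p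
  classify 0 _       = inj₁ refl
  classify 1 x-prime = contradiction x-prime (excluded 0 (<ᵇ⇒< 2 6 _) 2∣1+p)
  classify 2 _       = inj₂ (inj₁ refl)
  classify 3 x-prime = contradiction x-prime (excluded 2 (<ᵇ⇒< 2 6 _) (∣m∣n⇒∣m+n ∣-refl 2∣1+p))
  classify 4 x-prime = contradiction x-prime (excluded 3 (<ᵇ⇒< 3 6 _) (∣m∣n⇒∣m+n ∣-refl 3∣1+p))
  classify 5 x-prime = contradiction x-prime (excluded 4 (<ᵇ⇒< 2 6 _) (∣m∣n⇒∣m+n (divides 2 refl) 2∣1+p))
  classify (suc (suc (suc (suc (suc (suc o)))))) _ = inj₂ (inj₂ (+-monoʳ-≤ 6 (m≤n+m p o)))

-- Running out of fuel gives false, so the fuel can only make a check fail, never succeed wrongly.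
scan : (stop visit : ℕ → Bool) → (fuel p : ℕ) → Bool
scan stop visit zero       p = false
scan stop visit (suc fuel) p = stop p ∨ (visit p ∧ (visit (2 + p) ∧ scan stop visit fuel (6 + p)))

scan-sound : ∀ {stop visit} fuel {p x} → 6 ∣ suc p → p ≤ x → Prime x → (∀ {q} → q ≤ x → ¬ T (stop q)) →
             T (scan stop visit fuel p) → T (visit x)
scan-sound {stop} {visit} (suc fuel) {p} 6∣1+p p≤x x-prime never-stops scanned with to (T-∨ {stop p}) scanned
... | inj₁ stops = contradiction stops (never-stops p≤x)
... | inj₂ visits with to (T-∧ {visit p}) visits | prime-mod-6 6∣1+p p≤x x-prime
...   | visit-p , _    | inj₁ refl         = visit-p
...   | _       , rest | inj₂ (inj₁ refl)  = proj₁ (to (T-∧ {visit (2 + p)}) rest)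
...   | _       , rest | inj₂ (inj₂ 6+p≤x) =
        scan-sound {stop} {visit} fuel (∣m∣n⇒∣m+n ∣-refl 6∣1+p) 6+p≤x x-prime never-stops
          (proj₂ (to (T-∧ {visit (2 + p)}) rest))

scanStart : ℕ → ℕ
scanStart lo = 6 * ((lo ∸ 5) / 6) + 5

scanStart≤ : ∀ {lo} → 5 ≤ lo → scanStart lo ≤ lo
scanStart≤ {lo} 5≤lo = begin
  6 * ((lo ∸ 5) / 6) + 5  ≤⟨ +-monoˡ-≤ 5 (≤-trans (≤-reflexive (*-comm 6 ((lo ∸ 5) / 6))) (m/n*n≤m (lo ∸ 5) 6)) ⟩
  lo ∸ 5 + 5              ≡⟨ m∸n+n≡m 5≤lo ⟩
  lo                      ∎
  where open ≤-Reasoning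

6∣1+scanStart : ∀ lo → 6 ∣ suc (scanStart lo)
6∣1+scanStart lo = divides (suc ((lo ∸ 5) / 6)) (6*k+5+1 ((lo ∸ 5) / 6))
  where
  6*k+5+1 : ∀ k → suc (6 * k + 5) ≡ suc k * 6
  6*k+5+1 = solve-∀

lastPrimeTest : (E : ℕ → Bool) (b lo n d : ℕ) → Bool
lastPrimeTest E b lo n zero      = true
lastPrimeTest E b lo n d@(suc _) =
  (n % d ≡ᵇ 0) ⇒ᵇ ((lo ≤ᵇ n / d) ∧ passesTrialDivision smallPrimes (n / d)) ⇒ᵇ E (b * (n / d))

lastPrimeTest-sound : ∀ {E b lo q} d → 0 < d → lo ≤ q → Prime q →
                      T (lastPrimeTest E b lo (q * d) d) → T (E (b * q))
lastPrimeTest-sound zero () _ _ _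
lastPrimeTest-sound {E} {b} {lo} {q} d@(suc _) _ lo≤q q-prime passed
  rewrite m*n%n≡0 q d ⦃ _ ⦄ | m*n/n≡m q d ⦃ _ ⦄ =
  T-⇒ᵇ ((lo ≤ᵇ q) ∧ _) passed
    (from (T-∧ {lo ≤ᵇ q}) (≤⇒≤ᵇ lo≤q , prime⇒passesTrialDivision smallPrimes≥2 q-prime))

-- The fuel is an argument rather than a constant: with a literal fuel the type checker would unfold
-- scan to its full depth whenever it normalises a search over an unknown list.
search : (fuel : ℕ) (E : ℕ → Bool) (m a b lo : ℕ) → Bool
search fuel E zero          a b lo = (a ≡ᵇ b + 2) ⇒ᵇ E b
search fuel E (suc zero)    a b lo = lastPrimeTest E b lo (a + 2) (a ∸ b)
search fuel E (suc (suc m)) a b lo =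
  (a ≤ᵇ b) ∨ scan (exceedsBound (2 + m) a b)
                  -- Trial division only after the subsearch: cheaper when the subsearch is one division.
                  (λ p → (lo ≤ᵇ p) ⇒ᵇ (search fuel E (suc m) (a * (p ∸ 1)) (b * p) (suc p)
                                       ∨ not (passesTrialDivision smallPrimes p)))
                  fuel (scanStart lo)

search-sound : ∀ fuel E {lo a b} L → 5 ≤ lo → All (lo ≤_) L → AllPairs _<_ L → All Prime L →
               Solves a b L → T (search fuel E (length L) a b lo) → T (E (b * product L))
search-sound fuel E {a = a} {b} [] _ _ _ _ eq searched =
  subst (T ∘ E) (sym (*-identityʳ b)) (T-⇒ᵇ (a ≡ᵇ b + 2) searched (≡⇒≡ᵇ a (b + 2) a≡b+2))
  where
  a≡b+2 : a ≡ b + 2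
  a≡b+2 = trans (sym (*-identityʳ a)) (trans eq (cong (_+ 2) (*-identityʳ b)))
search-sound fuel E {lo} {a} {b} (q ∷ []) 5≤lo (lo≤q ∷ []) _ (q-prime ∷ []) eq searched =
  subst (T ∘ E) (cong (b *_) (sym (*-identityʳ q)))
    (lastPrimeTest-sound (a ∸ b) (m<n⇒0<n∸m b<a) lo≤q q-prime
      (subst (λ n → T (lastPrimeTest E b lo n (a ∸ b))) (sym (solves-singleton {a} {b} q≥1 eq)) searched))
  where
  q≥1 : 1 ≤ q
  q≥1 = ≤-trans (s≤s z≤n) (≤-trans 5≤lo lo≤q)
  b<a : b < a
  b<a = solution-b<a {a} {b} eq (predProduct≤product (q ∷ []))
search-sound fuel E {lo} {a} {b} (x ∷ L@(_ ∷ _)) 5≤lo (lo≤x ∷ _) (x<L ∷ L↑) (x-prime ∷ L-prime) eq searched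
  with to (T-∨ {a ≤ᵇ b}) searched
... | inj₁ a≤b = contradiction (≤ᵇ⇒≤ a b a≤b) (<⇒≱ (solution-b<a eq (predProduct≤product (x ∷ L))))
... | inj₂ scanned = subst (T ∘ E) (*-assoc b x (product L))
        (search-sound fuel E L (≤-trans 5≤lo (≤-trans lo≤x (n≤1+n x))) x<L L↑ L-prime eq′ subsearch)
  where
  eq′ : Solves (a * (x ∸ 1)) (b * x) L
  eq′ = trans (*-assoc a (x ∸ 1) _) (trans eq (cong (_+ 2) (sym (*-assoc b x _))))
  never-exceeds : ∀ {p} → p ≤ x → ¬ T (exceedsBound (length (x ∷ L)) a b p)
  never-exceeds p≤x = ¬exceedsBound {a} {b} (p≤x ∷ All.map (≤-trans p≤x ∘ <⇒≤) x<L) (x-prime ∷ L-prime) eq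
  visit-x : T ((lo ≤ᵇ x) ⇒ᵇ (search fuel E (length L) (a * (x ∸ 1)) (b * x) (suc x)
                            ∨ not (passesTrialDivision smallPrimes x)))
  visit-x = scan-sound fuel (6∣1+scanStart lo) (≤-trans (scanStart≤ 5≤lo) lo≤x) x-prime never-exceeds scanned
  subsearch : T (search fuel E (length L) (a * (x ∸ 1)) (b * x) (suc x))
  subsearch = T-∨-not _ (T-⇒ᵇ (lo ≤ᵇ x) visit-x (≤⇒≤ᵇ lo≤x)) (prime⇒passesTrialDivision smallPrimes≥2 x-prime)

-- Running the search

exceptions : List ℕ
exceptions = 5 ∷ 5 * 7 ∷ 5 * 7 * 37 ∷ 5 * 7 * 37 * 1297 ∷ []

isTwiceAnException : ℕ → Bool
isTwiceAnException v = any (λ e → v ≡ᵇ 2 * e) exceptions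

isTwiceAnException-sound : ∀ {n} → T (isTwiceAnException (2 * n)) → n ∈ exceptions
isTwiceAnException-sound {n} twice =
  Any.map (λ {e} 2n≡2e → *-cancelˡ-≡ n e 2 (≡ᵇ⇒≡ (2 * n) (2 * e) 2n≡2e)) (any⁻ _ exceptions twice)

searchFuel : ℕ
searchFuel = 100000000

short-searches : ∀ m → m ≤ 4 → search searchFuel isTwiceAnException m 3 2 5 ≡ true
short-searches 0 _ = refl
short-searches 1 _ = refl
short-searches 2 _ = refl
short-searches 3 _ = refl
short-searches 4 _ = refl
short-searches (suc (suc (suc (suc (suc _))))) (s≤s (s≤s (s≤s (s≤s ()))))

long-searches : ∀ {m} → m ≡ 5 ⊎ m ≡ 6 → search searchFuel (λ _ → false) m 3 2 5 ≡ true
long-searches (inj₁ refl) = refl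
long-searches (inj₂ refl) = refl

prime≥5 : ∀ {x} → Prime x → x ≢ 2 → x ≢ 3 → 5 ≤ x
prime≥5 {0} 0-prime _ _ = contradiction 0-prime ¬prime[0]
prime≥5 {1} 1-prime _ _ = contradiction 1-prime ¬prime[1]
prime≥5 {2} _ x≢2 _     = contradiction refl x≢2
prime≥5 {3} _ _ x≢3     = contradiction refl x≢3
prime≥5 {4} 4-prime _ _ = contradiction 4-prime (composite⇒¬prime composite[4])
prime≥5 {suc (suc (suc (suc (suc x))))} _ _ _ = m≤m+n 5 x

sort-primes≥5 : ∀ {Q} → Unique Q → All Prime Q → 2 ∉ Q → 3 ∉ Q →
                All (5 ≤_) (sort Q) × AllPairs _<_ (sort Q) × All Prime (sort Q)
sort-primes≥5 {Q} Q-unique Q-prime 2∉Q 3∉Q =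
  All-resp-↭ Q↭sortQ (All.tabulate ≥5) ,
  AllPairs.zipWith (λ (x≤y , x≢y) → ≤∧≢⇒< x≤y x≢y)
    (Linked⇒AllPairs ≤-trans (sort-↗ Q) , Permutationₛ.Unique-resp-↭ (setoid ℕ) (↭⇒↭ₛ Q↭sortQ) Q-unique) ,
  All-resp-↭ Q↭sortQ Q-prime
  where
  Q↭sortQ : Q ↭ sort Q
  Q↭sortQ = ↭-sym (sort-↭ Q)
  ≥5 : ∀ {x} → x ∈ Q → 5 ≤ x
  ≥5 x∈Q = prime≥5 (All.lookup Q-prime x∈Q) (λ { refl → 2∉Q x∈Q }) (λ { refl → 3∉Q x∈Q })

Solves-↭ : ∀ {a b L Q} → L ↭ Q → Solves a b Q → Solves a b L
Solves-↭ {a} {b} L↭Q eq =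
  trans (cong (a *_) (product-↭ (map⁺ (_∸ 1) L↭Q))) (trans eq (cong (λ x → b * x + 2) (sym (product-↭ L↭Q))))

prime-set-search-sound : ∀ fuel E {a b Q} → Unique Q → All Prime Q → 2 ∉ Q → 3 ∉ Q → Solves a b Q →
                         T (search fuel E (length Q) a b 5) → T (E (b * product Q))
prime-set-search-sound fuel E {a} {b} {Q} Q-unique Q-prime 2∉Q 3∉Q eq searched =
  subst (λ x → T (E (b * x))) (product-↭ sortQ↭Q)
    (search-sound fuel E (sort Q) ≤-refl ≥5 ascending primes (Solves-↭ {a} {b} sortQ↭Q eq)
      (subst (λ m → T (search fuel E m a b 5)) (sym (↭-length sortQ↭Q)) searched))
  where
  sortQ↭Q : sort Q ↭ Q
  sortQ↭Q = sort-↭ Q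
  ≥5 : All (5 ≤_) (sort Q)
  ≥5 = proj₁ (sort-primes≥5 Q-unique Q-prime 2∉Q 3∉Q)
  ascending : AllPairs _<_ (sort Q)
  ascending = proj₁ (proj₂ (sort-primes≥5 Q-unique Q-prime 2∉Q 3∉Q))
  primes : All Prime (sort Q)
  primes = proj₂ (proj₂ (sort-primes≥5 Q-unique Q-prime 2∉Q 3∉Q))

no-long-solution : ∀ {Q} → Unique Q → All Prime Q → 2 ∉ Q → 3 ∉ Q → length Q ≡ 5 ⊎ length Q ≡ 6 →
                   ¬ Solves 3 2 Q
no-long-solution Q-unique Q-prime 2∉Q 3∉Q length≡5∨6 eq =
  prime-set-search-sound searchFuel (λ _ → false) Q-unique Q-prime 2∉Q 3∉Q eq (from T-≡ (long-searches length≡5∨6))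

short-solution : ∀ {Q} → Unique Q → All Prime Q → 2 ∉ Q → 3 ∉ Q → length Q ≤ 4 → Solves 3 2 Q →
                 product Q ∈ exceptions
short-solution Q-unique Q-prime 2∉Q 3∉Q length≤4 eq = isTwiceAnException-sound
  (prime-set-search-sound searchFuel isTwiceAnException Q-unique Q-prime 2∉Q 3∉Q eq
    (from T-≡ (short-searches _ length≤4)))

≤6-cases : ∀ {m} → m ≤ 6 → m ≤ 4 ⊎ m ≡ 5 ⊎ m ≡ 6
≤6-cases m≤6 with m≤n⇒m<n∨m≡n m≤6
... | inj₂ m≡6 = inj₂ (inj₂ m≡6)
... | inj₁ m<6 with m≤n⇒m<n∨m≡n (≤-pred m<6)
...   | inj₁ m<5 = inj₁ (≤-pred m<5)
...   | inj₂ m≡5 = inj₂ (inj₁ m≡5)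

few-prime-factors⇒exception : ∀ {n P} → 1 ≤ n → TotientEquation n → IsPrimeFactorList n P → length P ≤ 6 →
                              n ∈ exceptions
few-prime-factors⇒exception {n} {P} 1≤n eq P-factors@(P-unique , P⇔) length≤6 = Sum.[
  (λ length≤4 → subst (_∈ exceptions) (sym n≡∏P) (short-solution P-unique P-prime 2∉P 3∉P length≤4 P-solves)) ,
  (λ length≡5∨6 → contradiction P-solves (no-long-solution P-unique P-prime 2∉P 3∉P length≡5∨6)) ]′
  (≤6-cases length≤6)
  where
  P-prime : All Prime P
  P-prime = All.tabulate (proj₁ ∘ to (P⇔ _))
  2∉P : 2 ∉ P
  2∉P = equation⇒odd eq ∘ proj₂ ∘ to (P⇔ 2)
  3∉P : 3 ∉ P
  3∉P = equation⇒3∤ eq ∘ proj₂ ∘ to (P⇔ 3)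
  n≡∏P : n ≡ product P
  n≡∏P = proj₁ (primeFactorList⇒product 1≤n (equation⇒squareFree eq) P-factors)
  φ≡∏P : totient n ≡ predProduct P
  φ≡∏P = proj₂ (primeFactorList⇒product 1≤n (equation⇒squareFree eq) P-factors)
  P-solves : Solves 3 2 P
  P-solves = begin
    3 * predProduct P    ≡⟨ cong (3 *_) φ≡∏P ⟨
    3 * totient n        ≡⟨ eq ⟩
    2 * (n + 1)          ≡⟨ *-distribˡ-+ 2 n 1 ⟩
    2 * n + 2            ≡⟨ cong (λ m → 2 * m + 2) n≡∏P ⟩
    2 * product P + 2    ∎
    where open ≡-Reasoning

pos-difference : ∀ {m n k} → + m ℤ.- + n ≡ + k → m ≡ n + k
pos-difference {m} {n} {k} eq = ℤ.+-injective (begin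
  + m                      ≡⟨ [i-j]+j≡i (+ m) (+ n) ⟨
  (+ m ℤ.- + n) ℤ.+ + n    ≡⟨ cong (ℤ._+ + n) eq ⟩
  + k ℤ.+ + n              ≡⟨ ℤ.+-comm (+ k) (+ n) ⟩
  + n ℤ.+ + k              ≡⟨ ℤ.pos-+ n k ⟨
  + (n + k)                ∎)
  where
  open ≡-Reasoning
  [i-j]+j≡i : ∀ i j → (i ℤ.- j) ℤ.+ j ≡ i
  [i-j]+j≡i = ℤ.solve-∀

ℤ-equation⇒Solves : ∀ {Q} → (+ 3) ℤ.* (+ predProduct Q) ℤ.- (+ 2) ℤ.* (+ product Q) ≡ + 2 → Solves 3 2 Q
ℤ-equation⇒Solves {Q} eq =
  pos-difference (trans (cong₂ ℤ._-_ (ℤ.pos-* 3 (predProduct Q)) (ℤ.pos-* 2 (product Q))) eq)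

theorem11 :
    (∀ (Q : List ℕ) → Unique Q → All Prime Q → 2 ∉ Q → 3 ∉ Q →
       (length Q ≡ 5 ⊎ length Q ≡ 6) →
       (+ 3) ℤ.* (+ product (map (λ q → q ∸ 1) Q)) ℤ.- (+ 2) ℤ.* (+ product Q) ≢ + 2)
    ×
    (∀ (n : ℕ) → 1 ≤ n → 3 * totient n ≡ 2 * (n + 1) →
       n ≢ 5 → n ≢ 5 * 7 → n ≢ 5 * 7 * 37 → n ≢ 5 * 7 * 37 * 1297 →
       ∀ (P : List ℕ) → IsPrimeFactorList n P → 7 ≤ length P)
theorem11 =
  (λ Q Q-unique Q-prime 2∉Q 3∉Q length≡5∨6 eq →
    no-long-solution Q-unique Q-prime 2∉Q 3∉Q length≡5∨6 (ℤ-equation⇒Solves {Q} eq)) ,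
  (λ n 1≤n eq n≢5 n≢35 n≢1295 n≢1679615 P P-factors → ≮⇒≥ λ length<7 →
    All¬⇒¬Any {P = n ≡_} (n≢5 ∷ n≢35 ∷ n≢1295 ∷ n≢1679615 ∷ [])
      (few-prime-factors⇒exception 1≤n eq P-factors (≤-pred length<7)))
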